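{- Let $\mathcal{A}$ be a semilinear equivariant deterministic finite automaton with the integer atoms, with state set $Q$, accepting states $F$, input alphabet $A$ and transition function $\delta$. Let $a_1,\ldots,a_n\in A$ be letters such that every orbit of $A$ contains some $a_i$, and let $\delta_i:Q\to Q$, $\delta_i(q)=\delta(q,a_i)$. Then an equivariant equivalence relation $\equiv$ on $Q$ is a congruence of $\mathcal{A}$ if and only if it respects the final states and is a congruence for the functions $\delta_1,\ldots,\delta_n$.
   Context: Integer atoms: the atoms are $\mathbb{Z}$ with successor; automorphisms are the translations $x\mapsto x+z$, acting hereditarily on sets built from atoms. Equivariant = invariant under all translations; orbit-finite = finite union of orbits. For $k\ge1$, $\mathbb{Z}_k$ is the integers mod $k$ with translations acting by addition, $\mathbb{Z}_0=\mathbb{Z}$; every equivariant single-orbit set is isomorphic to some $\mathbb{Z}_k$. A DFA with atoms has an orbit-finite equivariant alphabet $A$, orbit-finite equivariant state set $Q$, transition function $\delta:Q\times A\to Q$, initial state and accepting set $F$; equivariant if these are equivariant; semilinear if $\delta$ is a semilinear subset of $Q\times A\times Q$ (semilinear meaning Presburger-definable after identifying each product of single-orbit sets, via equivariant isomorphisms, with a disjoint union of sets $\mathbb{Z}^m$ and $\mathbb{Z}_k$, every subset of $\mathbb{Z}_k$, $k\ge1$, counting as semilinear). An equivalence $\equiv$ respects $F$ if $p\equiv q$ implies ($p\in F\iff q\in F$); it is a congruence for a function $g$ if $p\equiv q$ implies $g(p)\equiv g(q)$; it is a congruence of $\mathcal{A}$ if it respects $F$ and $p\equiv q$ implies $\delta(p,a)\equiv\delta(q,a)$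 for every $a\in A$. -}

module Defs where

open import Data.Nat as ℕ using (ℕ; zero; suc)
open import Data.Integer as ℤ using (ℤ; +_; _+_; _*_; _≤_)
open import Data.Integer.DivMod using (_%ℕ_; n%ℕd<d)
open import Data.Integer.Divisibility using (_∣_)
open import Data.Fin using (Fin; toℕ; fromℕ<)
open import Data.Product using (Σ; ∃; _×_; _,_)
open import Data.Sum using (_⊎_)
open import Data.Empty using (⊥)
open import Relation.Binary.PropositionalEquality using (_≡_)
open import Relation.Binary.Structures using (IsEquivalence)
open import Function.Bundles using (_⇔_)

-- Single-orbit equivariant sets with the integer atoms: ℤ_k
-- (ℤ_0 = ℤ, ℤ_k = integers mod k for k ≥ 1), translations act by addition.

Zk : ℕ → Set
Zk zero    = ℤ
Zk (suc k) = Fin (suc k)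

proj : (k : ℕ) → ℤ → Zk k
proj zero    x = x
proj (suc k) x = fromℕ< (n%ℕd<d x (suc k))

shift : (k : ℕ) → ℤ → Zk k → Zk k
shift zero    z x = z + x
shift (suc k) z x = proj (suc k) (z + + toℕ x)

-- Orbit-finite equivariant sets: every such set is (equivariantly
-- isomorphic to) a finite disjoint union of single-orbit sets ℤ_{k_i}.

record OFSet : Set where
  field
    orbits : ℕ
    period : Fin orbits → ℕ

Elem : OFSet → Set
Elem S = Σ (Fin (OFSet.orbits S)) (λ i → Zk (OFSet.period S i))

act : (S : OFSet) → ℤ → Elem S → Elem S
act S z (i , x) = i , shift (OFSet.period S i) z x

data Term (n : ℕ) : Set where
  var   : Fin n → Term n
  const : ℤ → Term n
  _⊕_   : Term n → Term n → Term n
  _⊛_   : ℤ → Term n → Term n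

data Form (n : ℕ) : Set where
  _≤ₚ_ : Term n → Term n → Form n
  _≐ₚ_ : Term n → Term n → Form n
  _∣ₚ_ : ℕ → Term n → Form n
  ¬ₚ_  : Form n → Form n
  _∧ₚ_ : Form n → Form n → Form n
  _∨ₚ_ : Form n → Form n → Form n
  ∃ₚ   : Form (suc n) → Form n
  ∀ₚ   : Form (suc n) → Form n

extend : ∀ {n} → ℤ → (Fin n → ℤ) → (Fin (suc n) → ℤ)
extend x ρ Fin.zero    = x
extend x ρ (Fin.suc i) = ρ i

⟦_⟧ₜ : ∀ {n} → Term n → (Fin n → ℤ) → ℤ
⟦ var i ⟧ₜ ρ   = ρ i
⟦ const c ⟧ₜ ρ = c
⟦ s ⊕ t ⟧ₜ ρ   = ⟦ s ⟧ₜ ρ + ⟦ t ⟧ₜ ρ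
⟦ c ⊛ t ⟧ₜ ρ   = c * ⟦ t ⟧ₜ ρ

⟦_⟧ : ∀ {n} → Form n → (Fin n → ℤ) → Set
⟦ s ≤ₚ t ⟧ ρ = ⟦ s ⟧ₜ ρ ≤ ⟦ t ⟧ₜ ρ
⟦ s ≐ₚ t ⟧ ρ = ⟦ s ⟧ₜ ρ ≡ ⟦ t ⟧ₜ ρ
⟦ k ∣ₚ t ⟧ ρ = + k ∣ ⟦ t ⟧ₜ ρ
⟦ ¬ₚ φ ⟧ ρ   = ⟦ φ ⟧ ρ → ⊥
⟦ φ ∧ₚ ψ ⟧ ρ = ⟦ φ ⟧ ρ × ⟦ ψ ⟧ ρ
⟦ φ ∨ₚ ψ ⟧ ρ = ⟦ φ ⟧ ρ ⊎ ⟦ ψ ⟧ ρ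
⟦ ∃ₚ φ ⟧ ρ   = Σ ℤ (λ x → ⟦ φ ⟧ (extend x ρ))
⟦ ∀ₚ φ ⟧ ρ   = (x : ℤ) → ⟦ φ ⟧ (extend x ρ)

env3 : ℤ → ℤ → ℤ → Fin 3 → ℤ
env3 x y w Fin.zero                   = x
env3 x y w (Fin.suc Fin.zero)         = y
env3 x y w (Fin.suc (Fin.suc _))      = w

record DFA : Set₁ where
  field
    A      : OFSet
    Q      : OFSet
    δ      : Elem Q → Elem A → Elem Q
    init   : Elem Q
    Final  : Elem Q → Set

module _ (𝒜 : DFA) where
  open DFA 𝒜

  IsEquivariant : Set
  IsEquivariant =
      (∀ z q a → δ (act Q z q) (act A z a) ≡ act Q z (δ q a))
    × (∀ z → act Q z init ≡ init)
    × (∀ z q → Final (act Q z q) ⇔ Final q)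

  -- semilinearity of δ ⊆ Q × A × Q: on each product of orbits
  -- ℤ_{k} × ℤ_{l} × ℤ_{m}, the graph of δ, pulled back along the
  -- canonical projections ℤ³ → ℤ_k × ℤ_l × ℤ_m, is Presburger-definable.
  IsSemilinear : Set
  IsSemilinear =
    ∀ (i : Fin (OFSet.orbits Q)) (j : Fin (OFSet.orbits A)) (l : Fin (OFSet.orbits Q)) →
    Σ (Form 3) λ φ → ∀ (x y w : ℤ) →
      ⟦ φ ⟧ (env3 x y w) ⇔
      (δ (i , proj (OFSet.period Q i) x) (j , proj (OFSet.period A j) y)
        ≡ (l , proj (OFSet.period Q l) w))

  EquivariantRel : (Elem Q → Elem Q → Set) → Set
  EquivariantRel R = ∀ z p q → R p q → R (act Q z p) (act Q z q)

  RespectsFinal : (Elem Q → Elem Q → Set) → Set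
  RespectsFinal R = ∀ p q → R p q → (Final p ⇔ Final q)

  CongruenceFor : (Elem Q → Elem Q → Set) → (Elem Q → Elem Q) → Set
  CongruenceFor R g = ∀ p q → R p q → R (g p) (g q)

  IsCongruence : (Elem Q → Elem Q → Set) → Set
  IsCongruence R = RespectsFinal R × (∀ a → CongruenceFor R (λ q → δ q a))

  CoversOrbits : ∀ {n} → (Fin n → Elem A) → Set
  CoversOrbits {n} as = ∀ (b : Elem A) → Σ (Fin n) λ i → Σ ℤ λ z → act A z (as i) ≡ b

-- If δ and ≡ are both equivariant, then being a congruence for the letter
-- z·a is the same as being a congruence for a: conjugating by the
-- translation z gives  δ(p, z·a) = z·δ((−z)·p, a),  so a pair p ≡ q is
-- moved to (−z)·p ≡ (−z)·q, stepped with a, and moved back.  The only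
-- arithmetic needed is that translating by −z and then by z is the
-- identity on every orbit ℤ_k; for k ≥ 1 this rests on the uniqueness of
-- Euclidean remainders in ℤ.
module Submission where

open import Defs
open import Data.Nat using (ℕ)
open import Data.Fin using (Fin)
open import Data.Product using (_×_)
open import Relation.Binary.Structures using (IsEquivalence)
open import Function.Bundles using (_⇔_)

import Data.Nat as ℕ
import Data.Nat.Properties as ℕ
open import Data.Nat.Divisibility using (divides; ∣⇒≤) renaming (_∣_ to _∣ℕ_)
open import Data.Integer as ℤ using (ℤ; +_; _+_; _-_; _*_; -_; ∣_∣)
import Data.Integer.Properties as ℤ
open import Data.Integer.DivMod using (_%ℕ_; _/ℕ_; n%ℕd<d; a≡a%ℕn+[a/ℕn]*n)
open import Data.Integer.Solver using (module +-*-Solver)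
import Data.Fin as Fin
import Data.Fin.Properties as Fin
open import Data.Product using (Σ; _,_)
open import Data.Empty using (⊥-elim)
open import Relation.Binary.PropositionalEquality
open import Function.Bundles using (mk⇔)

multiple-below-divisor : ∀ {d m} → d ∣ℕ m → m ℕ.< d → m ≡ 0
multiple-below-divisor {m = ℕ.zero}  _   _   = refl
multiple-below-divisor {m = ℕ.suc _} d∣m m<d = ⊥-elim (ℕ.<⇒≱ m<d (∣⇒≤ d∣m))

remainder-unique : ∀ d r r' (q q' : ℤ) → r ℕ.< d → r' ℕ.< d →
                   + r + q * + d ≡ + r' + q' * + d → r ≡ r'
remainder-unique d r r' q q' r<d r'<d eq =
  ℤ.+-injective (ℤ.i-j≡0⇒i≡j (+ r) (+ r') (ℤ.∣i∣≡0⇒i≡0 ∣r-r'∣≡0))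
  where
  open +-*-Solver
  open ≡-Reasoning

  difference : + r - + r' ≡ (q' - q) * + d
  difference = begin
    + r - + r'
      ≡⟨ solve 5 (λ R R' Q Q' D → R :- R' := ((R :+ Q :* D) :- (R' :+ Q' :* D)) :+ (Q' :- Q) :* D)
               refl (+ r) (+ r') q q' (+ d) ⟩
    ((+ r + q * + d) - (+ r' + q' * + d)) + (q' - q) * + d
      ≡⟨ cong (λ v → (v - (+ r' + q' * + d)) + (q' - q) * + d) eq ⟩
    ((+ r' + q' * + d) - (+ r' + q' * + d)) + (q' - q) * + d
      ≡⟨ cong (_+ (q' - q) * + d) (ℤ.+-inverseʳ (+ r' + q' * + d)) ⟩
    ℤ.0ℤ + (q' - q) * + d
      ≡⟨ ℤ.+-identityˡ _ ⟩
    (q' - q) * + d ∎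

  d-divides : d ∣ℕ ∣ + r - + r' ∣
  d-divides = divides ∣ q' - q ∣ (trans (cong ∣_∣ difference) (ℤ.abs-* (q' - q) (+ d)))

  below-d : ∣ + r - + r' ∣ ℕ.< d
  below-d = ℕ.≤-<-trans (subst (ℕ._≤ r ℕ.⊔ r') (cong ∣_∣ (sym (ℤ.m-n≡m⊖n r r'))) (ℤ.∣m⊝n∣≤m⊔n r r'))
                        (ℕ.⊔-lub r<d r'<d)

  ∣r-r'∣≡0 : ∣ + r - + r' ∣ ≡ 0
  ∣r-r'∣≡0 = multiple-below-divisor d-divides below-d

shift-inverse : ∀ k z x → shift k z (shift k (- z) x) ≡ x
shift-inverse ℕ.zero z x = begin
    z + (- z + x) ≡⟨ sym (ℤ.+-assoc z (- z) x) ⟩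
    (z - z) + x   ≡⟨ cong (_+ x) (ℤ.+-inverseʳ z) ⟩
    ℤ.0ℤ + x      ≡⟨ ℤ.+-identityˡ x ⟩
    x             ∎
  where open ≡-Reasoning
shift-inverse (ℕ.suc k) z x =
  Fin.toℕ-injective (trans (Fin.toℕ-fromℕ< _) remainder≡x)
  where
  d = ℕ.suc k
  a = - z + + Fin.toℕ x
  b = z + + (a %ℕ d)

  b-decomposition : b ≡ + Fin.toℕ x + (- (a /ℕ d)) * + d
  b-decomposition = begin
    z + + (a %ℕ d)
      ≡⟨ solve 4 (λ Z R Q D → Z :+ R := (Z :+ (R :+ Q :* D)) :+ (:- Q) :* D)
               refl z (+ (a %ℕ d)) (a /ℕ d) (+ d) ⟩
    (z + (+ (a %ℕ d) + (a /ℕ d) * + d)) + (- (a /ℕ d)) * + d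
      ≡⟨ cong (λ v → (z + v) + (- (a /ℕ d)) * + d) (sym (a≡a%ℕn+[a/ℕn]*n a d)) ⟩
    (z + a) + (- (a /ℕ d)) * + d
      ≡⟨ cong (_+ (- (a /ℕ d)) * + d) (shift-inverse ℕ.zero z (+ Fin.toℕ x)) ⟩
    + Fin.toℕ x + (- (a /ℕ d)) * + d ∎
    where
    open +-*-Solver
    open ≡-Reasoning

  remainder≡x : (z + + Fin.toℕ (Fin.fromℕ< (n%ℕd<d a d))) %ℕ d ≡ Fin.toℕ x
  remainder≡x rewrite Fin.toℕ-fromℕ< (n%ℕd<d a d) =
    remainder-unique d (b %ℕ d) (Fin.toℕ x) (b /ℕ d) (- (a /ℕ d))
      (n%ℕd<d b d) (Fin.toℕ<n x)
      (trans (sym (a≡a%ℕn+[a/ℕn]*n b d)) b-decomposition)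

act-inverse : ∀ S z p → act S z (act S (- z) p) ≡ p
act-inverse S z (i , x) = cong (i ,_) (shift-inverse (OFSet.period S i) z x)

module _ (𝒜 : DFA) where
  open DFA 𝒜

  EquivariantTransitions : Set
  EquivariantTransitions = ∀ z q a → δ (act Q z q) (act A z a) ≡ act Q z (δ q a)

  δ-conjugate : EquivariantTransitions → ∀ z p a →
                δ p (act A z a) ≡ act Q z (δ (act Q (- z) p) a)
  δ-conjugate eqδ z p a = begin
    δ p (act A z a)                         ≡⟨ cong (λ p' → δ p' (act A z a)) (sym (act-inverse Q z p)) ⟩
    δ (act Q z (act Q (- z) p)) (act A z a) ≡⟨ eqδ z (act Q (- z) p) a ⟩
    act Q z (δ (act Q (- z) p) a)           ∎
    where open ≡-Reasoning

  congruence-along-orbit : EquivariantTransitions →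
    ∀ {R} → EquivariantRel 𝒜 R → ∀ a → CongruenceFor 𝒜 R (λ q → δ q a) →
    ∀ z → CongruenceFor 𝒜 R (λ q → δ q (act A z a))
  congruence-along-orbit eqδ {R} eqR a cong-a z p q Rpq =
    subst₂ R (sym (δ-conjugate eqδ z p a)) (sym (δ-conjugate eqδ z q a))
      (eqR z _ _ (cong-a _ _ (eqR (- z) p q Rpq)))

lemma5 : (𝒜 : DFA) → IsSemilinear 𝒜 → IsEquivariant 𝒜 →
    (n : ℕ) (as : Fin n → Elem (DFA.A 𝒜)) → CoversOrbits 𝒜 as →
    (R : Elem (DFA.Q 𝒜) → Elem (DFA.Q 𝒜) → Set) → IsEquivalence R → EquivariantRel 𝒜 R →
    IsCongruence 𝒜 R ⇔ (RespectsFinal 𝒜 R × (∀ i → CongruenceFor 𝒜 R (λ q → DFA.δ 𝒜 q (as i))))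
lemma5 𝒜 _ (eqδ , _ , _) n as covers R _ eqR = mk⇔ restrict generalise
  where
  open DFA 𝒜

  restrict : IsCongruence 𝒜 R → RespectsFinal 𝒜 R × (∀ i → CongruenceFor 𝒜 R (λ q → δ q (as i)))
  restrict (respects , congruent) = respects , λ i → congruent (as i)

  generalise : RespectsFinal 𝒜 R × (∀ i → CongruenceFor 𝒜 R (λ q → δ q (as i))) → IsCongruence 𝒜 R
  generalise (respects , congruent) = respects , λ b → along (covers b)
    where
    along : ∀ {b} → Σ (Fin n) (λ i → Σ ℤ λ z → act A z (as i) ≡ b) → CongruenceFor 𝒜 R (λ q → δ q b)
    along (i , z , refl) = congruence-along-orbit 𝒜 eqδ eqR (as i) (congruent i) z
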